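{- Let $x \ge 0$ be a real number with $\varphi$-representation $x = \sum_{i \le t} e_i \varphi^i$, and suppose every exponent $i$ with $e_i = 1$ is even. Then $x$ is an integer if and only if the representation is antipalindromic, i.e. $e_i = e_{ -i}$ for every integer $i$.
   Context: $\varphi = (1+\sqrt{5})/2$. Every real $x \ge 0$ has a unique $\varphi$-representation (Bergman) $x = \sum_{i \le t} e_i \varphi^i$ with $e_i \in \{0,1\}$, such that $e_i e_{i+1} = 0$ for all $i$, and the digit sequence does not end in an infinite tail $1010\cdots$ (i.e. there is no $j$ with $e_{j-2k} = 1$ and $e_{j-2k-1} = 0$ for all $k \ge 0$). The exponents appearing in the representation are the integers $i$ with $e_i = 1$. -}

module Defs where

open import Data.Bool using (Bool; true; false)
open import Data.Nat as ℕ using (ℕ; zero; suc)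
open import Data.Integer using (ℤ; +_; -[1+_]; _+_; _-_; _*_; -_; _<_; _≤_)
open import Data.Product using (Σ; ∃; ∃-syntax; _×_; _,_)
open import Data.Sum using (_⊎_)
open import Relation.Binary.PropositionalEquality using (_≡_)
open import Relation.Nullary using (¬_)

-- Exact arithmetic in ℤ[φ] ⊂ ℝ, φ = (1+√5)/2, φ² = φ + 1.
-- An element  a + b·φ  is stored as  mk a b.

record ℤφ : Set where
  constructor mk
  field
    re : ℤ
    im : ℤ
open ℤφ public

_⊕_ : ℤφ → ℤφ → ℤφ
mk a b ⊕ mk c d = mk (a + c) (b + d)

_⊖_ : ℤφ → ℤφ → ℤφ
mk a b ⊖ mk c d = mk (a - c) (b - d)

_⊙_ : ℤ → ℤφ → ℤφ
n ⊙ mk a b = mk (n * a) (n * b)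

-- multiplication by φ :  (a + bφ)φ = b + (a+b)φ
timesφ : ℤφ → ℤφ
timesφ (mk a b) = mk b (a + b)

-- multiplication by φ⁻¹ = φ - 1 :  (a + bφ)(φ - 1) = (b - a) + aφ
timesφ⁻¹ : ℤφ → ℤφ
timesφ⁻¹ (mk a b) = mk (b - a) a

𝟘 𝟙 : ℤφ
𝟘 = mk (+ 0) (+ 0)
𝟙 = mk (+ 1) (+ 0)

fromℤ : ℤ → ℤφ
fromℤ n = mk n (+ 0)

iter : ℕ → (ℤφ → ℤφ) → ℤφ → ℤφ
iter zero    f x = x
iter (suc n) f x = f (iter n f x)

φ^ : ℤ → ℤφ
φ^ (+ n)     = iter n timesφ 𝟙
φ^ -[1+ n ]  = iter (suc n) timesφ⁻¹ 𝟙

-- Order on ℤ[φ] as a subset of ℝ.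
-- a + bφ = (p + q√5)/2 with p = 2a + b, q = b; we decide the sign of p + q√5.
Positive : ℤφ → Set
Positive (mk a b) =
    ((+ 0 < p) × (+ 0 ≤ q))
  ⊎ ((+ 0 ≤ p) × (+ 0 < q))
  ⊎ ((+ 0 < p) × (q < + 0) × (+ 5 * (q * q) < p * p))
  ⊎ ((p < + 0) × (+ 0 < q) × (p * p < + 5 * (q * q)))
  where
    p = (+ 2 * a) + b
    q = b

_<φ_ : ℤφ → ℤφ → Set
x <φ y = Positive (y ⊖ x)

_≤φ_ : ℤφ → ℤφ → Set
x ≤φ y = (x <φ y) ⊎ (x ≡ y)

digit : Bool → ℤφ
digit true  = 𝟙
digit false = 𝟘

term : (ℤ → Bool) → ℤ → ℤφ
term e i with e i
... | true  = φ^ i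
... | false = 𝟘

S : (ℤ → Bool) → ℕ → ℤφ
S e zero    = term e (+ 0)
S e (suc k) = (S e k ⊕ term e (+ suc k)) ⊕ term e -[1+ k ]

-- "Σ_i e_i φ^i = n" for a real series with nonnegative terms:
-- the (increasing) partial sums S e k are all ≤ n and come within
-- 1/(m+1) of n for every m, i.e. their supremum (= the limit) is n.
HasValue : (ℤ → Bool) → ℤ → Set
HasValue e n =
    (∀ k → S e k ≤φ fromℤ n)
  × (∀ m → ∃[ k ] ((+ suc m) ⊙ (fromℤ n ⊖ S e k)) <φ 𝟙)

IsIntegerValue : (ℤ → Bool) → Set
IsIntegerValue e = ∃[ n ] HasValue e n

BoundedAbove : (ℤ → Bool) → Set
BoundedAbove e = ∃[ t ] (∀ i → t < i → e i ≡ false)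

NoAdjacentOnes : (ℤ → Bool) → Set
NoAdjacentOnes e = ∀ i → ¬ ((e i ≡ true) × (e (i + + 1) ≡ true))

NoTail1010 : (ℤ → Bool) → Set
NoTail1010 e =
  ¬ (∃[ j ] (∀ (k : ℕ) → (e (j - + (2 ℕ.* k)) ≡ true)
                        × (e (j - + (2 ℕ.* k) - + 1) ≡ false)))

IsBergmanRep : (ℤ → Bool) → Set
IsBergmanRep e = BoundedAbove e × NoAdjacentOnes e × NoTail1010 e

AllExponentsEven : (ℤ → Bool) → Set
AllExponentsEven e = ∀ i → e i ≡ true → ∃[ m ] (i ≡ + 2 * m)

Antipalindromic : (ℤ → Bool) → Set
Antipalindromic e = ∀ i → e i ≡ e (- i)

module Submission where

-- Elements of ℤ[φ] are compared without real numbers: x = a + bφ determines the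
-- integer sequence fibSeq x j = a Fⱼ + b Fⱼ₊₁, the coefficient of φ in x φʲ.  It equals
-- (x φʲ - x̄ ψʲ)/√5, where ψ = -φ⁻¹ and x̄ is the conjugate of x, so for large j it has
-- the sign of x.  Comparing these sequences for large j orders ℤ[φ] as an ordered group,
-- and x <φ y implies that x is below y in this eventual order.
--
-- Split the partial sums of the expansion as P + Nₖ, where P collects the finitely many
-- nonnegative exponents and Nₖ the exponents -1, …, -k.  The mirror image
-- Qₖ = Σ_{0 < i ≤ k} eᵢ φ⁻ⁱ of P satisfies P + Qₖ = L ∈ ℤ, because φⁱ + φ⁻ⁱ ∈ ℤ for
-- even i.  Sums of distinct even negative powers of φ stay below φ⁻¹, so the value
-- L + N - Q lies within φ⁻¹ < 1 of L, and an integer value must be L itself, that is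
-- N = Q.  At the first exponent -(a+1) where e and its mirror image differ, the digit 1
-- outweighs all later digits of the other side by φ⁻⁽ᵃ⁺³⁾, which contradicts N = Q.
-- Conversely, antipalindromic partial sums are P + Q: integers, eventually constant.

open import Defs
open import Data.Bool using (Bool; true; false)
open import Data.Integer using (ℤ)
open import Function.Bundles using (_⇔_; mk⇔)

open import Data.Empty using (⊥; ⊥-elim)
open import Data.Integer as ℤ using (+_; -[1+_]; _+_; _-_; _*_; -_; _<_; _≤_; ∣_∣; +<+; +≤+)
import Data.Integer.Properties as ℤP
open import Data.Integer.Tactic.RingSolver using (solve-∀)
open import Data.Nat as ℕ using (ℕ; zero; suc; s≤s; _≤′_; ≤′-refl; ≤′-step)
import Data.Nat.Properties as ℕP
open import Data.Nat.Induction using (<-rec; <-wellFounded)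
open import Data.Parity.Base using (0ℙ; _⁻¹)
import Data.Parity.Properties as ℙP
open import Data.Product using (∃; ∃-syntax; _×_; _,_; proj₁; proj₂; map)
open import Data.Sum using (_⊎_; inj₁; inj₂)
open import Function.Base using (_∘_)
open import Induction.WellFounded using (Acc; acc)
open import Relation.Binary.Definitions using (_Respects₂_; tri<; tri≈; tri>)
open import Relation.Binary.PropositionalEquality
open import Relation.Binary.Structures using (IsPreorder)
import Relation.Binary.Reasoning.Base.Triple as TripleReasoning
open import Relation.Nullary using (¬_; yes; no; contradiction)
open import Relation.Nullary.Decidable using (True; toWitness)

private variable
  x y z u : ℤφ
  a k k′ T : ℕ
  i : ℤ
  e v w : ℤ → Bool

Eventually : (ℕ → Set) → Set
Eventually P = ∃[ k ] (∀ {j} → k ℕ.≤ j → P j)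

eventually-map : {P Q : ℕ → Set} → (∀ {j} → P j → Q j) → Eventually P → Eventually Q
eventually-map f (k , p) = k , λ k≤j → f (p k≤j)

eventually-zipWith : {P Q R : ℕ → Set} → (∀ {j} → P j → Q j → R j) →
                     Eventually P → Eventually Q → Eventually R
eventually-zipWith f (k , p) (l , q) =
  k ℕ.⊔ l , λ k⊔l≤j → f (p (ℕP.m⊔n≤o⇒m≤o k l k⊔l≤j)) (q (ℕP.m⊔n≤o⇒n≤o k l k⊔l≤j))

eventually-offset : {P : ℕ → Set} (s : ℕ) → Eventually (λ i → P (s ℕ.+ i)) → Eventually P
eventually-offset {P} s (k , p) = k ℕ.+ s , λ k+s≤j →
  subst P (ℕP.m+[n∸m]≡n (ℕP.m+n≤o⇒n≤o k k+s≤j)) (p (ℕP.m+n≤o⇒m≤o∸n k k+s≤j))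

≤-induction : {P : ℕ → Set} → P k → (∀ {j} → k ℕ.≤ j → P j → P (suc j)) →
              ∀ {j} → k ℕ.≤ j → P j
≤-induction {k} {P} base step k≤j = go (ℕP.≤⇒≤′ k≤j)
  where
  go : ∀ {j} → k ≤′ j → P j
  go ≤′-refl        = base
  go (≤′-step k≤′j) = step (ℕP.≤′⇒≤ k≤′j) (go k≤′j)

⊕-identityʳ : ∀ x → x ⊕ 𝟘 ≡ x
⊕-identityʳ x = cong₂ mk (ℤP.+-identityʳ (re x)) (ℤP.+-identityʳ (im x))

⊕-comm : ∀ x y → x ⊕ y ≡ y ⊕ x
⊕-comm x y = cong₂ mk (ℤP.+-comm (re x) (re y)) (ℤP.+-comm (im x) (im y))

⊕-assoc : ∀ x y z → (x ⊕ y) ⊕ z ≡ x ⊕ (y ⊕ z)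
⊕-assoc x y z = cong₂ mk (ℤP.+-assoc (re x) (re y) (re z)) (ℤP.+-assoc (im x) (im y) (im z))

⊕-interchange : ∀ x y z u → (x ⊕ y) ⊕ (z ⊕ u) ≡ (x ⊕ z) ⊕ (y ⊕ u)
⊕-interchange x y z u =
  cong₂ mk (interchange (re x) (re y) (re z) (re u)) (interchange (im x) (im y) (im z) (im u))
  where
  interchange : ∀ a b c d → (a + b) + (c + d) ≡ (a + c) + (b + d)
  interchange = solve-∀

⊕-⊖-cancelˡ : ∀ x y z → (x ⊕ y) ⊖ (x ⊕ z) ≡ y ⊖ z
⊕-⊖-cancelˡ x y z = cong₂ mk (cancel (re x) (re y) (re z)) (cancel (im x) (im y) (im z))
  where
  cancel : ∀ a b c → (a + b) - (a + c) ≡ b - c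
  cancel = solve-∀

⊕-⊖-assoc : ∀ x y z → x ⊕ (y ⊖ z) ≡ (x ⊕ y) ⊖ z
⊕-⊖-assoc x y z = cong₂ mk (assoc (re x) (re y) (re z)) (assoc (im x) (im y) (im z))
  where
  assoc : ∀ a b c → a + (b - c) ≡ (a + b) - c
  assoc = solve-∀

⊖-self : ∀ x → x ⊖ x ≡ 𝟘
⊖-self x = cong₂ mk (ℤP.+-inverseʳ (re x)) (ℤP.+-inverseʳ (im x))

⊙-𝟘 : ∀ c → c ⊙ 𝟘 ≡ 𝟘
⊙-𝟘 c = cong₂ mk (ℤP.*-zeroʳ c) (ℤP.*-zeroʳ c)

integral⇒fromℤ : im x ≡ + 0 → x ≡ fromℤ (re x)
integral⇒fromℤ {x} = cong (mk (re x))

fib : ℕ → ℤ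
fib zero          = + 0
fib (suc zero)    = + 1
fib (suc (suc j)) = fib (suc j) + fib j

fib-nonneg : ∀ j → + 0 ≤ fib j
fib-nonneg zero          = ℤP.≤-refl
fib-nonneg (suc zero)    = +≤+ ℕ.z≤n
fib-nonneg (suc (suc j)) = ℤP.+-mono-≤ (fib-nonneg (suc j)) (fib-nonneg j)

fib-pos : ∀ j → + 0 < fib (suc j)
fib-pos zero    = +<+ (s≤s ℕ.z≤n)
fib-pos (suc j) = ℤP.+-mono-<-≤ (fib-pos j) (fib-nonneg j)

fib-mono : ∀ j → fib j ≤ fib (suc j)
fib-mono zero    = +≤+ ℕ.z≤n
fib-mono (suc j) = ℤP.i≤i+j (fib (suc j)) (fib j) {{ℤ.nonNegative (fib-nonneg j)}}

fib-growth : ∀ s → ∃[ m ] ∀ i → fib (s ℕ.+ suc i) ≤ + suc m * fib (suc i)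
fib-growth zero = 0 , λ i → ℤP.≤-reflexive (sym (ℤP.*-identityˡ (fib (suc i))))
fib-growth (suc s) with fib-growth s
... | m , bound = m ℕ.+ suc m , λ i → begin
  fib (suc s ℕ.+ suc i)                         ≡⟨ cong (fib ∘ suc) (ℕP.+-suc s i) ⟩
  fib (suc (s ℕ.+ i)) + fib (s ℕ.+ i)           ≤⟨ ℤP.+-monoʳ-≤ (fib (suc (s ℕ.+ i)))
                                                                 (fib-mono (s ℕ.+ i)) ⟩
  fib (suc (s ℕ.+ i)) + fib (suc (s ℕ.+ i))     ≡⟨ cong (λ j → fib j + fib j) (ℕP.+-suc s i) ⟨
  fib (s ℕ.+ suc i) + fib (s ℕ.+ suc i)         ≤⟨ ℤP.+-mono-≤ (bound i) (bound i) ⟩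
  + suc m * fib (suc i) + + suc m * fib (suc i) ≡⟨ ℤP.*-distribʳ-+ (fib (suc i)) (+ suc m) (+ suc m)
                                                 ⟨
  + suc (m ℕ.+ suc m) * fib (suc i)             ∎
  where open ℤP.≤-Reasoning

fibSeq : ℤφ → ℕ → ℤ
fibSeq (mk a b) j = a * fib j + b * fib (suc j)

fibSeq-⊕ : ∀ x y j → fibSeq (x ⊕ y) j ≡ fibSeq x j + fibSeq y j
fibSeq-⊕ (mk a b) (mk c d) j = identity a b c d (fib j) (fib (suc j))
  where
  identity : ∀ a b c d f g → (a + c) * f + (b + d) * g ≡ (a * f + b * g) + (c * f + d * g)
  identity = solve-∀

fibSeq-⊖ : ∀ x y j → fibSeq (x ⊖ y) j ≡ fibSeq x j - fibSeq y j
fibSeq-⊖ (mk a b) (mk c d) j = identity a b c d (fib j) (fib (suc j))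
  where
  identity : ∀ a b c d f g → (a - c) * f + (b - d) * g ≡ (a * f + b * g) - (c * f + d * g)
  identity = solve-∀

fibSeq-⊙ : ∀ c x j → fibSeq (c ⊙ x) j ≡ c * fibSeq x j
fibSeq-⊙ c (mk a b) j = identity c a b (fib j) (fib (suc j))
  where
  identity : ∀ c a b f g → (c * a) * f + (c * b) * g ≡ c * (a * f + b * g)
  identity = solve-∀

fibSeq-fromℤ : ∀ n j → fibSeq (fromℤ n) j ≡ n * fib j
fibSeq-fromℤ n j = ℤP.+-identityʳ (n * fib j)

fibSeq-𝟙 : ∀ j → fibSeq 𝟙 j ≡ fib j
fibSeq-𝟙 j = trans (fibSeq-fromℤ (+ 1) j) (ℤP.*-identityˡ (fib j))

fibSeq-zero : ∀ x → fibSeq x 0 ≡ im x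
fibSeq-zero (mk a b) = identity a b
  where
  identity : ∀ a b → a * + 0 + b * + 1 ≡ b
  identity = solve-∀

fibSeq-suc-suc : ∀ x j → fibSeq x (suc (suc j)) ≡ fibSeq x (suc j) + fibSeq x j
fibSeq-suc-suc (mk a b) j = identity a b (fib j) (fib (suc j))
  where
  identity : ∀ a b f g →
             a * (g + f) + b * ((g + f) + g) ≡ (a * g + b * (g + f)) + (a * f + b * g)
  identity = solve-∀

fibSeq-timesφ : ∀ x j → fibSeq (timesφ x) j ≡ fibSeq x (suc j)
fibSeq-timesφ (mk a b) j = identity a b (fib j) (fib (suc j))
  where
  identity : ∀ a b f g → b * f + (a + b) * g ≡ a * g + b * (g + f)
  identity = solve-∀

fibSeq-timesφ⁻¹ : ∀ x j → fibSeq (timesφ⁻¹ x) (suc j) ≡ fibSeq x j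
fibSeq-timesφ⁻¹ (mk a b) j = identity a b (fib j) (fib (suc j))
  where
  identity : ∀ a b f g → (b - a) * g + a * (g + f) ≡ a * f + b * g
  identity = solve-∀

fibSeq-φ^+ : ∀ n j → fibSeq (φ^ (+ n)) j ≡ fib (n ℕ.+ j)
fibSeq-φ^+ n j = trans (shift n j) (fibSeq-𝟙 (n ℕ.+ j))
  where
  shift : ∀ n j → fibSeq (iter n timesφ 𝟙) j ≡ fibSeq 𝟙 (n ℕ.+ j)
  shift zero    j = refl
  shift (suc n) j = begin
    fibSeq (timesφ (iter n timesφ 𝟙)) j ≡⟨ fibSeq-timesφ (iter n timesφ 𝟙) j ⟩
    fibSeq (iter n timesφ 𝟙) (suc j)    ≡⟨ shift n (suc j) ⟩
    fibSeq 𝟙 (n ℕ.+ suc j)              ≡⟨ cong (fibSeq 𝟙) (ℕP.+-suc n j) ⟩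
    fibSeq 𝟙 (suc n ℕ.+ j)              ∎
    where open ≡-Reasoning

fibSeq-φ^-[1+] : ∀ n j → fibSeq (φ^ -[1+ n ]) (suc n ℕ.+ j) ≡ fib j
fibSeq-φ^-[1+] n j = trans (shift (suc n) j) (fibSeq-𝟙 j)
  where
  shift : ∀ n j → fibSeq (iter n timesφ⁻¹ 𝟙) (n ℕ.+ j) ≡ fibSeq 𝟙 j
  shift zero    j = refl
  shift (suc n) j = trans (fibSeq-timesφ⁻¹ (iter n timesφ⁻¹ 𝟙) (n ℕ.+ j)) (shift n j)

-- The eventual order on ℤ[φ]

infix 4 _≼_ _≺_

record _≼_ (x y : ℤφ) : Set where
  constructor mk≼
  field eventually-≤ : Eventually (λ j → fibSeq x j ≤ fibSeq y j)

record _≺_ (x y : ℤφ) : Set where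
  constructor mk≺
  field eventually-< : Eventually (λ j → fibSeq x j < fibSeq y j)

≼-reflexive : x ≡ y → x ≼ y
≼-reflexive refl = mk≼ (0 , λ _ → ℤP.≤-refl)

≼-refl : x ≼ x
≼-refl = ≼-reflexive refl

≼-trans : x ≼ y → y ≼ z → x ≼ z
≼-trans (mk≼ x≤y) (mk≼ y≤z) = mk≼ (eventually-zipWith ℤP.≤-trans x≤y y≤z)

≺-trans : x ≺ y → y ≺ z → x ≺ z
≺-trans (mk≺ x<y) (mk≺ y<z) = mk≺ (eventually-zipWith ℤP.<-trans x<y y<z)

≺-≼-trans : x ≺ y → y ≼ z → x ≺ z
≺-≼-trans (mk≺ x<y) (mk≼ y≤z) = mk≺ (eventually-zipWith ℤP.<-≤-trans x<y y≤z)

≼-≺-trans : x ≼ y → y ≺ z → x ≺ z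
≼-≺-trans (mk≼ x≤y) (mk≺ y<z) = mk≺ (eventually-zipWith ℤP.≤-<-trans x≤y y<z)

≺⇒≼ : x ≺ y → x ≼ y
≺⇒≼ (mk≺ x<y) = mk≼ (eventually-map ℤP.<⇒≤ x<y)

≺-asym : x ≺ y → ¬ y ≺ x
≺-asym (mk≺ x<y) (mk≺ y<x) with eventually-zipWith ℤP.<-asym x<y y<x
... | k , never = never ℕP.≤-refl

≺-resp-≡ : _≺_ Respects₂ _≡_
≺-resp-≡ = (λ {x} → subst (x ≺_)) , (λ {y} → subst (_≺ y))

≼-isPreorder : IsPreorder _≡_ _≼_
≼-isPreorder = record
  { isEquivalence = isEquivalence
  ; reflexive     = ≼-reflexive
  ; trans         = ≼-trans
  }

module ≼-Reasoning =
  TripleReasoning ≼-isPreorder ≺-asym ≺-trans ≺-resp-≡ ≺⇒≼ ≺-≼-trans ≼-≺-trans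

⊕-mono-≼ : x ≼ y → z ≼ u → x ⊕ z ≼ y ⊕ u
⊕-mono-≼ {x} {y} {z} {u} (mk≼ x≤y) (mk≼ z≤u) = mk≼ (eventually-zipWith (λ {j} x≤y z≤u →
  subst₂ _≤_ (sym (fibSeq-⊕ x z j)) (sym (fibSeq-⊕ y u j)) (ℤP.+-mono-≤ x≤y z≤u)) x≤y z≤u)

⊕-mono-≼-≺ : x ≼ y → z ≺ u → x ⊕ z ≺ y ⊕ u
⊕-mono-≼-≺ {x} {y} {z} {u} (mk≼ x≤y) (mk≺ z<u) = mk≺ (eventually-zipWith (λ {j} x≤y z<u →
  subst₂ _<_ (sym (fibSeq-⊕ x z j)) (sym (fibSeq-⊕ y u j)) (ℤP.+-mono-≤-< x≤y z<u)) x≤y z<u)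

⊖-mono-≼ : x ≼ y → z ≼ u → x ⊖ u ≼ y ⊖ z
⊖-mono-≼ {x} {y} {z} {u} (mk≼ x≤y) (mk≼ z≤u) = mk≼ (eventually-zipWith (λ {j} x≤y z≤u →
  subst₂ _≤_ (sym (fibSeq-⊖ x u j)) (sym (fibSeq-⊖ y z j))
    (ℤP.+-mono-≤ x≤y (ℤP.neg-mono-≤ z≤u))) x≤y z≤u)

⊙-monoʳ-≼ : ∀ c → x ≼ y → (+ c) ⊙ x ≼ (+ c) ⊙ y
⊙-monoʳ-≼ {x} {y} c (mk≼ x≤y) = mk≼ (eventually-map (λ {j} x≤y →
  subst₂ _≤_ (sym (fibSeq-⊙ (+ c) x j)) (sym (fibSeq-⊙ (+ c) y j))
    (ℤP.*-monoˡ-≤-nonNeg (+ c) x≤y)) x≤y)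

⊕-monoˡ-≼ : ∀ z → x ≼ y → x ⊕ z ≼ y ⊕ z
⊕-monoˡ-≼ z x≼y = ⊕-mono-≼ x≼y (≼-refl {z})

⊕-monoʳ-≼ : ∀ x → y ≼ z → x ⊕ y ≼ x ⊕ z
⊕-monoʳ-≼ x = ⊕-mono-≼ (≼-refl {x})

⊕-monoʳ-≺ : ∀ x → y ≺ z → x ⊕ y ≺ x ⊕ z
⊕-monoʳ-≺ x = ⊕-mono-≼-≺ (≼-refl {x})

⊖-monoˡ-≼ : ∀ z → x ≼ y → x ⊖ z ≼ y ⊖ z
⊖-monoˡ-≼ z x≼y = ⊖-mono-≼ x≼y (≼-refl {z})

⊖-monoʳ-≼ : ∀ x → y ≼ z → x ⊖ z ≼ x ⊖ y
⊖-monoʳ-≼ x = ⊖-mono-≼ (≼-refl {x})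

x≼x⊕y : ∀ x → 𝟘 ≼ y → x ≼ x ⊕ y
x≼x⊕y {y} x 𝟘≼y = subst (_≼ x ⊕ y) (⊕-identityʳ x) (⊕-monoʳ-≼ x 𝟘≼y)

x≺x⊕y : ∀ x → 𝟘 ≺ y → x ≺ x ⊕ y
x≺x⊕y {y} x 𝟘≺y = subst (_≺ x ⊕ y) (⊕-identityʳ x) (⊕-monoʳ-≺ x 𝟘≺y)

⊕-≼⇒≼-⊖ : x ⊕ y ≼ z → y ≼ z ⊖ x
⊕-≼⇒≼-⊖ {x} {y} {z} (mk≼ x+y≤z) = mk≼ (eventually-map (λ {j} x+y≤z →
  subst₂ _≤_ (cancel (fibSeq x j) (fibSeq y j)) (sym (fibSeq-⊖ z x j))
    (ℤP.+-monoˡ-≤ (- fibSeq x j) (subst (_≤ fibSeq z j) (fibSeq-⊕ x y j) x+y≤z))) x+y≤z)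
  where
  cancel : ∀ i j → i + j - i ≡ j
  cancel = solve-∀

fromℤ-mono-≼ : ∀ {m n} → m ≤ n → fromℤ m ≼ fromℤ n
fromℤ-mono-≼ {m} {n} m≤n = mk≼ (0 , λ {j} _ →
  subst₂ _≤_ (sym (fibSeq-fromℤ m j)) (sym (fibSeq-fromℤ n j))
    (ℤP.*-monoʳ-≤-nonNeg (fib j) {{ℤ.nonNegative (fib-nonneg j)}} m≤n))

fromℤ-cancel-≼ : ∀ {m n} → fromℤ m ≼ fromℤ n → m ≤ n
fromℤ-cancel-≼ {m} {n} (mk≼ (k , m≤n)) =
  ℤP.*-cancelʳ-≤-pos m n (fib (suc k)) {{ℤ.positive (fib-pos k)}}
    (subst₂ _≤_ (fibSeq-fromℤ m (suc k)) (fibSeq-fromℤ n (suc k)) (m≤n (ℕP.n≤1+n k)))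

-- Positive elements are eventually positive

record Start (x : ℤφ) (k : ℕ) : Set where
  constructor start
  field
    nonneg : + 0 ≤ fibSeq x k
    pos    : + 0 < fibSeq x (suc k)

start-suc : Start x k → Start x (suc k)
start-suc {x} {k} (start 0≤u 0<v) =
  start (ℤP.<⇒≤ 0<v) (subst (+ 0 <_) (sym (fibSeq-suc-suc x k)) (ℤP.+-mono-<-≤ 0<v 0≤u))

start-timesφ : Start (timesφ x) k → Start x (suc k)
start-timesφ {x} {k} (start 0≤u 0<v) =
  start (subst (+ 0 ≤_) (fibSeq-timesφ x k) 0≤u) (subst (+ 0 <_) (fibSeq-timesφ x (suc k)) 0<v)

start-zero : + 0 ≤ im x → + 0 < re x + im x → Start x 0
start-zero {x} 0≤b 0<a+b =
  start (subst (+ 0 ≤_) (sym (fibSeq-zero x)) 0≤b)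
        (subst (+ 0 <_) (trans (sym (fibSeq-zero (timesφ x))) (fibSeq-timesφ x 0)) 0<a+b)

start⇒𝟘≺ : Start x k → 𝟘 ≺ x
start⇒𝟘≺ {x} {k} s =
  mk≺ (suc k , λ { (s≤s k≤j) → Start.pos (≤-induction {P = Start x} s (λ _ → start-suc) k≤j) })

0≤* : ∀ {i j} → + 0 ≤ i → + 0 ≤ j → + 0 ≤ i * j
0≤* {i} {j} 0≤i 0≤j =
  subst (_≤ i * j) (ℤP.*-zeroʳ i) (ℤP.*-monoˡ-≤-nonNeg i {{ℤ.nonNegative 0≤i}} 0≤j)

0≤n* : ∀ n {j} → + 0 ≤ j → + 0 ≤ + n * j
0≤n* n = 0≤* {+ n} (+≤+ ℕ.z≤n)

≤-by-nonneg : ∀ {i j r} → + 0 ≤ r → i + r ≡ j → i ≤ j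
≤-by-nonneg {i} {j} {r} 0≤r i+r≡j = subst (i ≤_) i+r≡j (ℤP.i≤i+j i r {{ℤ.nonNegative 0≤r}})

a+b≡c+d∧d<b⇒a<c : ∀ {a b c d} → a + b ≡ c + d → d < b → a < c
a+b≡c+d∧d<b⇒a<c a+b≡c+d d<b =
  ℤP.≰⇒> λ c≤a → ℤP.<-irrefl (sym a+b≡c+d) (ℤP.+-mono-≤-< c≤a d<b)

0<i+j⇒-j<i : ∀ {i j} → + 0 < i + j → - j < i
0<i+j⇒-j<i {i} {j} 0<i+j =
  subst₂ _<_ (ℤP.+-identityˡ (- j)) (cancel i j) (ℤP.+-monoˡ-< (- j) 0<i+j)
  where
  cancel : ∀ i j → i + j - j ≡ i
  cancel = solve-∀

0<j-i⇒i<j : ∀ {i j} → + 0 < j - i → i < j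
0<j-i⇒i<j {i} 0<j-i = subst (_< _) (ℤP.neg-involutive i) (0<i+j⇒-j<i 0<j-i)

i<0<j+i⇒∣i∣<∣j∣ : ∀ {i j} → i < + 0 → + 0 < j + i → ∣ i ∣ ℕ.< ∣ j ∣
i<0<j+i⇒∣i∣<∣j∣ {+ _} (+<+ ()) _
i<0<j+i⇒∣i∣<∣j∣ { -[1+ m ]} {j} _ 0<j+i with 0<i+j⇒-j<i {j} { -[1+ m ]} 0<j+i
... | +<+ m<n = m<n

5q²<p²⇒0<p+q : ∀ {p q} → + 0 < p → + 5 * (q * q) < p * p → + 0 < p + q
5q²<p²⇒0<p+q {p} {q} 0<p 5q²<p² = ℤP.≰⇒> λ p+q≤0 →
  ℤP.<⇒≱ 5q²<p² (≤-by-nonneg (nonneg (ℤP.<⇒≤ 0<p) (ℤP.neg-mono-≤ p+q≤0)) (certificate p q))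
  where
  nonneg : ∀ {p s} → + 0 ≤ p → + 0 ≤ s → + 0 ≤ + 4 * (p * p) + + 10 * (p * s) + + 5 * (s * s)
  nonneg 0≤p 0≤s = ℤP.+-mono-≤ (ℤP.+-mono-≤ (0≤n* 4 (0≤* 0≤p 0≤p)) (0≤n* 10 (0≤* 0≤p 0≤s)))
                               (0≤n* 5 (0≤* 0≤s 0≤s))
  certificate : ∀ p q → p * p + (+ 4 * (p * p) + + 10 * (p * - (p + q))
                                  + + 5 * (- (p + q) * - (p + q)))
                        ≡ + 5 * (q * q)
  certificate = solve-∀

p²<5q²⇒0<p+5q : ∀ {p q} → + 0 < q → p * p < + 5 * (q * q) → + 0 < p + + 5 * q
p²<5q²⇒0<p+5q {p} {q} 0<q p²<5q² = ℤP.≰⇒> λ p+5q≤0 →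
  ℤP.<⇒≱ p²<5q² (≤-by-nonneg (nonneg (ℤP.<⇒≤ 0<q) (ℤP.neg-mono-≤ p+5q≤0)) (certificate p q))
  where
  nonneg : ∀ {q s} → + 0 ≤ q → + 0 ≤ s → + 0 ≤ + 20 * (q * q) + + 10 * (q * s) + s * s
  nonneg 0≤q 0≤s = ℤP.+-mono-≤ (ℤP.+-mono-≤ (0≤n* 20 (0≤* 0≤q 0≤q)) (0≤n* 10 (0≤* 0≤q 0≤s)))
                               (0≤* 0≤s 0≤s)
  certificate : ∀ p q → + 5 * (q * q) + (+ 20 * (q * q) + + 10 * (q * - (p + + 5 * q))
                                          + - (p + + 5 * q) * - (p + + 5 * q))
                        ≡ p * p
  certificate = solve-∀

positive-of-q>0 : ∀ c d → + 0 < d → (+ 2 * c + d) * (+ 2 * c + d) < + 5 * (d * d) →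
                  Positive (mk c d)
positive-of-q>0 c d 0<q p²<5q² with + 0 ℤP.≤? + 2 * c + d
... | yes 0≤p = inj₂ (inj₁ (0≤p , 0<q))
... | no  p≱0 = inj₂ (inj₂ (inj₂ (ℤP.≰⇒> p≱0 , 0<q , p²<5q²)))

positive-of-p>0 : ∀ c d → + 0 < + 2 * c + d → + 5 * (d * d) < (+ 2 * c + d) * (+ 2 * c + d) →
                  Positive (mk c d)
positive-of-p>0 c d 0<p 5q²<p² with + 0 ℤP.≤? d
... | yes 0≤q = inj₁ (0<p , 0≤q)
... | no  q≱0 = inj₂ (inj₂ (inj₁ (0<p , ℤP.≰⇒> q≱0 , 5q²<p²)))

-- In the notation of Positive, x = (p + q√5)/2.  Then φx = (p′ + q′√5)/2 with
-- p′ = (p + 5q)/2 and q′ = (p + q)/2, and p′² - 5q′² = -(p² - 5q²).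

0<p+q⇒0<q′ : ∀ a b → + 0 < (+ 2 * a + b) + b → + 0 < a + b
0<p+q⇒0<q′ a b = ℤP.*-cancelˡ-<-nonNeg (+ 2) ∘ subst (+ 0 <_) (double a b)
  where
  double : ∀ a b → (+ 2 * a + b) + b ≡ + 2 * (a + b)
  double = solve-∀

0<p+5q⇒0<p′ : ∀ a b → + 0 < (+ 2 * a + b) + + 5 * b → + 0 < + 2 * b + (a + b)
0<p+5q⇒0<p′ a b = ℤP.*-cancelˡ-<-nonNeg (+ 2) ∘ subst (+ 0 <_) (double a b)
  where
  double : ∀ a b → (+ 2 * a + b) + + 5 * b ≡ + 2 * (+ 2 * b + (a + b))
  double = solve-∀

norm-timesφ : ∀ a b → (+ 2 * b + (a + b)) * (+ 2 * b + (a + b)) + (+ 2 * a + b) * (+ 2 * a + b)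
                      ≡ + 5 * ((a + b) * (a + b)) + + 5 * (b * b)
norm-timesφ = solve-∀

Positive-timesφ : ∀ x → Positive x → Positive (timesφ x)
Positive-timesφ (mk a b) (inj₁ (0<p , 0≤q)) =
  inj₁ (0<p+5q⇒0<p′ a b (ℤP.+-mono-<-≤ 0<p (0≤n* 5 0≤q)) ,
        ℤP.<⇒≤ (0<p+q⇒0<q′ a b (ℤP.+-mono-<-≤ 0<p 0≤q)))
Positive-timesφ (mk a b) (inj₂ (inj₁ (0≤p , 0<q))) =
  inj₁ (0<p+5q⇒0<p′ a b (ℤP.+-mono-≤-< 0≤p (ℤP.*-monoˡ-<-pos (+ 5) 0<q)) ,
        ℤP.<⇒≤ (0<p+q⇒0<q′ a b (ℤP.+-mono-≤-< 0≤p 0<q)))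
Positive-timesφ (mk a b) (inj₂ (inj₂ (inj₁ (0<p , _ , 5q²<p²)))) =
  positive-of-q>0 b (a + b) (0<p+q⇒0<q′ a b (5q²<p²⇒0<p+q {+ 2 * a + b} 0<p 5q²<p²))
    (a+b≡c+d∧d<b⇒a<c (norm-timesφ a b) 5q²<p²)
Positive-timesφ (mk a b) (inj₂ (inj₂ (inj₂ (_ , 0<q , p²<5q²)))) =
  positive-of-p>0 b (a + b) (0<p+5q⇒0<p′ a b (p²<5q²⇒0<p+5q {+ 2 * a + b} 0<q p²<5q²))
    (a+b≡c+d∧d<b⇒a<c (sym (norm-timesφ a b)) p²<5q²)

start-or-shrink : ∀ x → Positive x → ∃ (Start x) ⊎ ∣ im x ∣ ℕ.< ∣ re x ∣
start-or-shrink (mk a b) (inj₁ (0<p , 0≤q)) =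
  inj₁ (0 , start-zero 0≤q (0<p+q⇒0<q′ a b (ℤP.+-mono-<-≤ 0<p 0≤q)))
start-or-shrink (mk a b) (inj₂ (inj₁ (0≤p , 0<q))) =
  inj₁ (0 , start-zero (ℤP.<⇒≤ 0<q) (0<p+q⇒0<q′ a b (ℤP.+-mono-≤-< 0≤p 0<q)))
start-or-shrink (mk a b) (inj₂ (inj₂ (inj₁ (0<p , q<0 , 5q²<p²)))) =
  inj₂ (i<0<j+i⇒∣i∣<∣j∣ {b} {a} q<0 (0<p+q⇒0<q′ a b (5q²<p²⇒0<p+q {+ 2 * a + b} 0<p 5q²<p²)))
start-or-shrink (mk a b) (inj₂ (inj₂ (inj₂ (_ , 0<q , _)))) with ℤP.<-cmp (+ 0) (a + b)
... | tri< 0<a+b _ _ = inj₁ (0 , start-zero (ℤP.<⇒≤ 0<q) 0<a+b)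
... | tri≈ _ 0≡a+b _ = inj₁ (1 , start-timesφ (start-zero (ℤP.≤-reflexive 0≡a+b)
        (subst (λ s → + 0 < b + s) 0≡a+b (subst (+ 0 <_) (sym (ℤP.+-identityʳ b)) 0<q))))
... | tri> _ _ a+b<0 = inj₂ (subst₂ ℕ._<_ (ℤP.∣-i∣≡∣i∣ b) (ℤP.∣-i∣≡∣i∣ a)
        (i<0<j+i⇒∣i∣<∣j∣ { - b} { - a} (ℤP.neg-mono-< 0<q)
          (subst (+ 0 <_) (ℤP.neg-distrib-+ a b) (ℤP.neg-mono-< a+b<0))))

-- Multiplication by φ moves the coefficients along fibSeq x and shrinks ∣ re x ∣,
-- until two consecutive terms are nonnegative and positive.
positive⇒start : ∀ x → Acc ℕ._<_ ∣ re x ∣ → Positive x → ∃ (Start x)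
positive⇒start x (acc smaller) pos with start-or-shrink x pos
... | inj₁ started = started
... | inj₂ shrinks =
  map suc start-timesφ (positive⇒start (timesφ x) (smaller shrinks) (Positive-timesφ x pos))

Positive⇒𝟘≺ : Positive x → 𝟘 ≺ x
Positive⇒𝟘≺ {x} pos = start⇒𝟘≺ (proj₂ (positive⇒start x (<-wellFounded ∣ re x ∣) pos))

<φ⇒≺ : x <φ y → x ≺ y
<φ⇒≺ {x} {y} x<y with Positive⇒𝟘≺ {y ⊖ x} x<y
... | mk≺ 0<y-x = mk≺ (eventually-map (λ {j} 0<y-x →
  0<j-i⇒i<j (subst (+ 0 <_) (fibSeq-⊖ y x j) 0<y-x)) 0<y-x)

≤φ⇒≼ : x ≤φ y → x ≼ y
≤φ⇒≼ (inj₁ x<y)  = ≺⇒≼ (<φ⇒≺ x<y)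
≤φ⇒≼ (inj₂ refl) = ≼-refl

decide : ∀ {i j} {i<j : True (i ℤP.<? j)} → i < j
decide {i<j = i<j} = toWitness i<j

𝟘≺φ^-[1+_] : ∀ n → 𝟘 ≺ φ^ -[1+ n ]
𝟘≺φ^-[1+ n ] = mk≺ (eventually-offset (suc n) (1 , λ { {suc i} _ →
  subst (+ 0 <_) (sym (fibSeq-φ^-[1+] n (suc i))) (fib-pos i) }))

𝟘≼φ^ : ∀ i → 𝟘 ≼ φ^ i
𝟘≼φ^ (+ n)     = mk≼ (0 , λ {j} _ → subst (+ 0 ≤_) (sym (fibSeq-φ^+ n j)) (fib-nonneg (n ℕ.+ j)))
𝟘≼φ^ -[1+ n ] = ≺⇒≼ 𝟘≺φ^-[1+ n ]

φ^-[1+]-split : ∀ n → φ^ -[1+ n ] ≡ φ^ -[1+ suc n ] ⊕ φ^ -[1+ suc (suc n) ]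
φ^-[1+]-split n = split (φ^ -[1+ n ])
  where
  split : ∀ x → x ≡ timesφ⁻¹ x ⊕ timesφ⁻¹ (timesφ⁻¹ x)
  split (mk a b) = cong₂ mk (re-identity a b) (im-identity a b)
    where
    re-identity : ∀ a b → a ≡ (b - a) + (a - (b - a))
    re-identity = solve-∀
    im-identity : ∀ a b → b ≡ a + (b - a)
    im-identity = solve-∀

φ^-[1+]-archimedean : ∀ s → ∃[ m ] 𝟙 ≼ (+ suc m) ⊙ φ^ -[1+ s ]
φ^-[1+]-archimedean s with fib-growth (suc s)
... | m , bound = m , mk≼ (eventually-offset (suc s) (1 , λ { {suc i} _ →
  subst₂ _≤_ (sym (fibSeq-𝟙 (suc s ℕ.+ suc i)))
             (sym (trans (fibSeq-⊙ (+ suc m) (φ^ -[1+ s ]) (suc s ℕ.+ suc i))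
                         (cong (+ suc m *_) (fibSeq-φ^-[1+] s (suc i)))))
             (bound i) }))

φ⁻¹≺𝟙 : φ^ -[1+ 0 ] ≺ 𝟙
φ⁻¹≺𝟙 = <φ⇒≺ (inj₂ (inj₂ (inj₁ (decide , decide , decide))))

𝟙≺3⊙[1-φ⁻¹] : 𝟙 ≺ (+ 3) ⊙ (𝟙 ⊕ (𝟘 ⊖ φ^ -[1+ 0 ]))
𝟙≺3⊙[1-φ⁻¹] = <φ⇒≺ (inj₂ (inj₂ (inj₁ (decide , decide , decide))))

-- conj (a + bφ) = a + bψ = (a + b) - bφ, with ψ = 1 - φ = -φ⁻¹.
conj : ℤφ → ℤφ
conj (mk a b) = mk (a + b) (- b)

im-⊕-conj : ∀ x → im (x ⊕ conj x) ≡ + 0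
im-⊕-conj x = ℤP.+-inverseʳ (im x)

conj-timesφ² : ∀ x → conj (timesφ (timesφ x)) ≡ timesφ⁻¹ (timesφ⁻¹ (conj x))
conj-timesφ² (mk a b) = cong₂ mk (re-identity a b) (im-identity a b)
  where
  re-identity : ∀ a b → (a + b) + (b + (a + b)) ≡ (a + b) - (- b - (a + b))
  re-identity = solve-∀
  im-identity : ∀ a b → - (b + (a + b)) ≡ - b - (a + b)
  im-identity = solve-∀

φ^-neg-even : ∀ n → ℕ.parity n ≡ 0ℙ → iter n timesφ⁻¹ 𝟙 ≡ conj (φ^ (+ n))
φ^-neg-even zero          _    = refl
φ^-neg-even (suc (suc n)) even =
  trans (cong (timesφ⁻¹ ∘ timesφ⁻¹) (φ^-neg-even n even)) (sym (conj-timesφ² (φ^ (+ n))))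

VanishesAbove : ℕ → (ℤ → Bool) → Set
VanishesAbove T e = ∀ i → + T < i → e i ≡ false

reflect : (ℤ → Bool) → ℤ → Bool
reflect e i = e (- i)

term-true : e i ≡ true → term e i ≡ φ^ i
term-true eᵢ rewrite eᵢ = refl

term-false : e i ≡ false → term e i ≡ 𝟘
term-false eᵢ rewrite eᵢ = refl

term-cong : v i ≡ w i → term v i ≡ term w i
term-cong {v} {i} {w} vᵢ≡wᵢ with v i | w i
... | true  | true  = refl
... | false | false = refl
... | true  | false = contradiction vᵢ≡wᵢ λ ()
... | false | true  = contradiction vᵢ≡wᵢ λ ()

term-≼-φ^ : ∀ e i → term e i ≼ φ^ i
term-≼-φ^ e i with e i
... | true  = ≼-refl
... | false = 𝟘≼φ^ i

𝟘≼term : ∀ e i → 𝟘 ≼ term e i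
𝟘≼term e i with e i
... | true  = 𝟘≼φ^ i
... | false = ≼-refl

exponent-even : AllExponentsEven e → e i ≡ true → ℕ.parity ∣ i ∣ ≡ 0ℙ
exponent-even {e} {i} even eᵢ with even i eᵢ
... | m , refl = trans (cong ℕ.parity (ℤP.abs-* (+ 2) m)) (ℙP.*-homo-* 2 ∣ m ∣)

odd-exponent-absent : AllExponentsEven v → ℕ.parity a ≡ 0ℙ → v -[1+ a ] ≡ false
odd-exponent-absent {v} {a} even a-even with v -[1+ a ] in vₐ
... | false = refl
... | true  = contradiction
  (trans (sym (cong _⁻¹ (exponent-even even vₐ))) (trans (ℙP.suc-homo-⁻¹ a) a-even)) λ ()

reflect-even : AllExponentsEven e → AllExponentsEven (reflect e)
reflect-even even i eᵢ with even (- i) eᵢ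
... | m , -i≡2m = - m , (begin
  i             ≡⟨ ℤP.neg-involutive i ⟨
  - (- i)       ≡⟨ cong -_ -i≡2m ⟩
  - (+ 2 * m)   ≡⟨ ℤP.neg-distribʳ-* (+ 2) m ⟩
  + 2 * (- m)   ∎)
  where open ≡-Reasoning

posPart negPart : (ℤ → Bool) → ℕ → ℤφ
posPart e zero    = term e (+ 0)
posPart e (suc k) = posPart e k ⊕ term e (+ suc k)
negPart e zero    = 𝟘
negPart e (suc k) = negPart e k ⊕ term e -[1+ k ]

S-split : ∀ e k → S e k ≡ posPart e k ⊕ negPart e k
S-split e zero    = sym (⊕-identityʳ (term e (+ 0)))
S-split e (suc k) = begin
  (S e k ⊕ t) ⊕ t′                          ≡⟨ cong (λ s → (s ⊕ t) ⊕ t′) (S-split e k) ⟩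
  ((posPart e k ⊕ negPart e k) ⊕ t) ⊕ t′    ≡⟨ ⊕-assoc (posPart e k ⊕ negPart e k) t t′ ⟩
  (posPart e k ⊕ negPart e k) ⊕ (t ⊕ t′)    ≡⟨ ⊕-interchange (posPart e k) (negPart e k) t t′ ⟩
  (posPart e k ⊕ t) ⊕ (negPart e k ⊕ t′)    ∎
  where
  open ≡-Reasoning
  t  = term e (+ suc k)
  t′ = term e -[1+ k ]

≼-mono : {f : ℕ → ℤφ} → (∀ k → f k ≼ f (suc k)) → k ℕ.≤ k′ → f k ≼ f k′
≼-mono {k} {f = f} step =
  ≤-induction {P = λ j → f k ≼ f j} ≼-refl (λ {j} _ fk≼fj → ≼-trans fk≼fj (step j))

S-mono : ∀ e → k ℕ.≤ k′ → S e k ≼ S e k′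
S-mono e = ≼-mono (λ k → ≼-trans (x≼x⊕y (S e k) (𝟘≼term e (+ suc k)))
                                  (x≼x⊕y (S e k ⊕ term e (+ suc k)) (𝟘≼term e -[1+ k ])))

negPart-mono : ∀ v → k ℕ.≤ k′ → negPart v k ≼ negPart v k′
negPart-mono v = ≼-mono (λ k → x≼x⊕y (negPart v k) (𝟘≼term v -[1+ k ]))

𝟘≼negPart : ∀ v k → 𝟘 ≼ negPart v k
𝟘≼negPart v k = negPart-mono v ℕ.z≤n

stationary : {f : ℕ → ℤφ} → (∀ {k} → T ℕ.≤ k → f (suc k) ≡ f k) → T ℕ.≤ k → f k ≡ f T
stationary {T} {f = f} step =
  ≤-induction {P = λ j → f j ≡ f T} refl (λ T≤j fj≡fT → trans (step T≤j) fj≡fT)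

posPart-stable : VanishesAbove T e → T ℕ.≤ k → posPart e k ≡ posPart e T
posPart-stable {e = e} vanish = stationary λ {k} T≤k →
  trans (cong (posPart e k ⊕_) (term-false {e} {+ suc k} (vanish (+ suc k) (+<+ (s≤s T≤k)))))
        (⊕-identityʳ (posPart e k))

negPart-reflect-stable : VanishesAbove T e → T ℕ.≤ k → negPart (reflect e) k ≡ negPart (reflect e) T
negPart-reflect-stable {e = e} vanish = stationary λ {k} T≤k →
  trans (cong (negPart (reflect e) k ⊕_)
              (term-false {reflect e} { -[1+ k ]} (vanish (+ suc k) (+<+ (s≤s T≤k)))))
        (⊕-identityʳ (negPart (reflect e) k))

negPart-cong : (∀ {b} → b ℕ.< a → v -[1+ b ] ≡ w -[1+ b ]) → negPart v a ≡ negPart w a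
negPart-cong {zero}          _     = refl
negPart-cong {suc a} {v} {w} agree =
  cong₂ _⊕_ (negPart-cong (agree ∘ ℕP.m<n⇒m<1+n)) (term-cong {v} { -[1+ a ]} {w} (agree ℕP.≤-refl))

-- φⁱ and φ⁻ⁱ are conjugate for even i, so their sum is an integer.
posPart⊕mirror-integral : AllExponentsEven e → ∀ k → im (posPart e k ⊕ negPart (reflect e) k) ≡ + 0
posPart⊕mirror-integral {e} even zero with e (+ 0)
... | true  = refl
... | false = refl
posPart⊕mirror-integral {e} even (suc k) = begin
  im ((posPart e k ⊕ t) ⊕ (negPart (reflect e) k ⊕ t′))
    ≡⟨ cong im (⊕-interchange (posPart e k) t (negPart (reflect e) k) t′) ⟩
  im (posPart e k ⊕ negPart (reflect e) k) + im (t ⊕ t′)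
    ≡⟨ cong₂ _+_ (posPart⊕mirror-integral even k) pair ⟩
  + 0 ∎
  where
  open ≡-Reasoning
  t  = term e (+ suc k)
  t′ = term (reflect e) -[1+ k ]
  pair : im (t ⊕ t′) ≡ + 0
  pair with e (+ suc k) in eₖ
  ... | false = refl
  ... | true  =
    trans (cong (λ y → im (φ^ (+ suc k) ⊕ y)) (φ^-neg-even (suc k) (exponent-even even eₖ)))
          (im-⊕-conj (φ^ (+ suc k)))

-- The digit at the odd exponent -(a+1) is 0, so the digits below add up to at most
-- φ⁻⁽ᵃ⁺²⁾ + φ⁻⁽ᵃ⁺⁴⁾ + ⋯ = φ⁻⁽ᵃ⁺¹⁾.
negPart-tail-≼ : AllExponentsEven v → ℕ.parity a ≡ 0ℙ →
                 ∀ d → negPart v (d ℕ.+ a) ≼ negPart v a ⊕ φ^ -[1+ a ]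
negPart-tail-≼ {v} {a} even a-even zero          = x≼x⊕y (negPart v a) (𝟘≼φ^ -[1+ a ])
negPart-tail-≼ {v} {a} even a-even (suc zero)    = ⊕-monoʳ-≼ (negPart v a) (term-≼-φ^ v -[1+ a ])
negPart-tail-≼ {v} {a} even a-even (suc (suc d)) = begin
  negPart v (suc (suc d) ℕ.+ a)
    ≡⟨ cong (negPart v) (+-suc² d a) ⟨
  negPart v (d ℕ.+ suc (suc a))
    ≤⟨ negPart-tail-≼ even a-even d ⟩
  ((negPart v a ⊕ term v -[1+ a ]) ⊕ t) ⊕ φ⁻ᵃ⁻³
    ≡⟨ cong (λ s → ((negPart v a ⊕ s) ⊕ t) ⊕ φ⁻ᵃ⁻³) (term-false {v} { -[1+ a ]} odd) ⟩
  ((negPart v a ⊕ 𝟘) ⊕ t) ⊕ φ⁻ᵃ⁻³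
    ≤⟨ ⊕-monoˡ-≼ φ⁻ᵃ⁻³ (⊕-monoʳ-≼ (negPart v a ⊕ 𝟘) (term-≼-φ^ v -[1+ suc a ])) ⟩
  ((negPart v a ⊕ 𝟘) ⊕ φ^ -[1+ suc a ]) ⊕ φ⁻ᵃ⁻³
    ≡⟨ cong (λ s → (s ⊕ φ^ -[1+ suc a ]) ⊕ φ⁻ᵃ⁻³) (⊕-identityʳ (negPart v a)) ⟩
  (negPart v a ⊕ φ^ -[1+ suc a ]) ⊕ φ⁻ᵃ⁻³
    ≡⟨ ⊕-assoc (negPart v a) (φ^ -[1+ suc a ]) φ⁻ᵃ⁻³ ⟩
  negPart v a ⊕ (φ^ -[1+ suc a ] ⊕ φ⁻ᵃ⁻³)
    ≡⟨ cong (negPart v a ⊕_) (φ^-[1+]-split a) ⟨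
  negPart v a ⊕ φ^ -[1+ a ]
    ∎
  where
  open ≼-Reasoning
  t      = term v -[1+ suc a ]
  φ⁻ᵃ⁻³  = φ^ -[1+ suc (suc a) ]
  odd    = odd-exponent-absent {v} {a} even a-even
  +-suc² : ∀ d a → d ℕ.+ suc (suc a) ≡ suc (suc (d ℕ.+ a))
  +-suc² d a = trans (ℕP.+-suc d (suc a)) (cong suc (ℕP.+-suc d a))

negPart-≼-φ⁻¹ : AllExponentsEven v → ∀ k → negPart v k ≼ φ^ -[1+ 0 ]
negPart-≼-φ⁻¹ {v} even k =
  subst (λ j → negPart v j ≼ φ^ -[1+ 0 ]) (ℕP.+-identityʳ k) (negPart-tail-≼ even refl k)

-- w's digit at the first disagreement outweighs everything v has below it:
-- φ⁻⁽ᵃ⁺¹⁾ - φ⁻⁽ᵃ⁺²⁾ = φ⁻⁽ᵃ⁺³⁾.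
first-difference : AllExponentsEven v → AllExponentsEven w → negPart v a ≡ negPart w a →
                   v -[1+ a ] ≡ false → w -[1+ a ] ≡ true →
                   ∀ K → suc a ℕ.≤ k → negPart v K ⊕ φ^ -[1+ suc (suc a) ] ≼ negPart w k
first-difference {v} {w} {a} {k} v-even w-even same vₐ wₐ K a<k = begin
  negPart v K ⊕ φ⁻ᵃ⁻³
    ≤⟨ ⊕-monoˡ-≼ φ⁻ᵃ⁻³ (negPart-mono v (ℕP.m≤m+n K (suc a))) ⟩
  negPart v (K ℕ.+ suc a) ⊕ φ⁻ᵃ⁻³
    ≤⟨ ⊕-monoˡ-≼ φ⁻ᵃ⁻³ (negPart-tail-≼ v-even a+1-even K) ⟩
  (negPart v (suc a) ⊕ φ^ -[1+ suc a ]) ⊕ φ⁻ᵃ⁻³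
    ≡⟨ ⊕-assoc (negPart v (suc a)) (φ^ -[1+ suc a ]) φ⁻ᵃ⁻³ ⟩
  negPart v (suc a) ⊕ (φ^ -[1+ suc a ] ⊕ φ⁻ᵃ⁻³)
    ≡⟨ cong₂ _⊕_ v-prefix (φ^-[1+]-split a) ⟨
  negPart w a ⊕ φ^ -[1+ a ]
    ≡⟨ cong (negPart w a ⊕_) (term-true {w} { -[1+ a ]} wₐ) ⟨
  negPart w (suc a)
    ≤⟨ negPart-mono w a<k ⟩
  negPart w k
    ∎
  where
  open ≼-Reasoning
  φ⁻ᵃ⁻³ = φ^ -[1+ suc (suc a) ]
  a+1-even = exponent-even w-even wₐ
  v-prefix : negPart w a ≡ negPart v (suc a)
  v-prefix = sym (trans (cong (negPart v a ⊕_) (term-false {v} { -[1+ a ]} vₐ))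
                        (trans (⊕-identityʳ (negPart v a)) same))

module IntegerValue⇒Antipalindromic
  (e : ℤ → Bool) (even : AllExponentsEven e) (T : ℕ) (vanish : VanishesAbove T e)
  (n : ℤ) (value : HasValue e n) where

  open ≼-Reasoning

  P : ℤφ
  P = posPart e T

  Q N : ℕ → ℤφ
  Q = negPart (reflect e)
  N = negPart e

  L : ℤ
  L = re (P ⊕ Q T)

  below : ∀ k → S e k ≼ fromℤ n
  below k = ≤φ⇒≼ (proj₁ value k)

  approx : ∀ m K → ∃[ k ] K ℕ.≤ k × (+ suc m) ⊙ (fromℤ n ⊖ S e k) ≺ 𝟙
  approx m K with proj₂ value m
  ... | k , close = k ℕ.+ K , ℕP.m≤n+m K k , (begin-strict
    (+ suc m) ⊙ (fromℤ n ⊖ S e (k ℕ.+ K)) ≤⟨ ⊙-monoʳ-≼ (suc m)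
                                               (⊖-monoʳ-≼ (fromℤ n) (S-mono e (ℕP.m≤m+n k K))) ⟩
    (+ suc m) ⊙ (fromℤ n ⊖ S e k)         <⟨ <φ⇒≺ close ⟩
    𝟙                                     ∎)

  pairing : T ℕ.≤ k → P ⊕ Q k ≡ fromℤ L
  pairing T≤k = trans (cong (P ⊕_) (negPart-reflect-stable vanish T≤k))
                      (integral⇒fromℤ (posPart⊕mirror-integral even T))

  split : T ℕ.≤ k → S e k ≡ P ⊕ N k
  split {k} T≤k = trans (S-split e k) (cong (_⊕ N k) (posPart-stable vanish T≤k))

  gap : T ℕ.≤ k → fromℤ L ⊖ S e k ≡ Q k ⊖ N k
  gap {k} T≤k = trans (cong₂ _⊖_ (sym (pairing T≤k)) (split T≤k)) (⊕-⊖-cancelˡ P (Q k) (N k))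

  gap-lower : ∀ k → 𝟘 ⊖ φ^ -[1+ 0 ] ≼ Q k ⊖ N k
  gap-lower k = ⊖-mono-≼ (𝟘≼negPart (reflect e) k) (negPart-≼-φ⁻¹ even k)

  n≮L : ¬ n < L
  n≮L n<L = begin-contradiction
    𝟙 ⊕ fromℤ n             ≤⟨ fromℤ-mono-≼ (ℤP.i<j⇒suc[i]≤j n<L) ⟩
    fromℤ L                 ≡⟨ pairing ℕP.≤-refl ⟨
    P ⊕ Q T                 ≤⟨ ⊕-mono-≼ (x≼x⊕y P (𝟘≼negPart e T))
                                          (negPart-≼-φ⁻¹ (reflect-even even) T) ⟩
    (P ⊕ N T) ⊕ φ^ -[1+ 0 ] <⟨ ⊕-monoʳ-≺ (P ⊕ N T) φ⁻¹≺𝟙 ⟩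
    (P ⊕ N T) ⊕ 𝟙           ≡⟨ cong (_⊕ 𝟙) (split ℕP.≤-refl) ⟨
    S e T ⊕ 𝟙               ≤⟨ ⊕-monoˡ-≼ 𝟙 (below T) ⟩
    fromℤ n ⊕ 𝟙             ≡⟨ ⊕-comm (fromℤ n) 𝟙 ⟩
    𝟙 ⊕ fromℤ n             ∎

  L≮n : ¬ L < n
  L≮n L<n =
    let k , T≤k , close = approx 2 T in
    begin-contradiction
    𝟙                                  <⟨ 𝟙≺3⊙[1-φ⁻¹] ⟩
    (+ 3) ⊙ (𝟙 ⊕ (𝟘 ⊖ φ^ -[1+ 0 ]))    ≤⟨ ⊙-monoʳ-≼ 3 (⊕-monoʳ-≼ 𝟙 (gap-lower k)) ⟩
    (+ 3) ⊙ (𝟙 ⊕ (Q k ⊖ N k))          ≡⟨ cong (λ d → (+ 3) ⊙ (𝟙 ⊕ d)) (gap T≤k) ⟨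
    (+ 3) ⊙ (𝟙 ⊕ (fromℤ L ⊖ S e k))    ≡⟨ cong ((+ 3) ⊙_) (⊕-⊖-assoc 𝟙 (fromℤ L) (S e k)) ⟩
    (+ 3) ⊙ ((𝟙 ⊕ fromℤ L) ⊖ S e k)    ≤⟨ ⊙-monoʳ-≼ 3 (⊖-monoˡ-≼ (S e k)
                                              (fromℤ-mono-≼ (ℤP.i<j⇒suc[i]≤j L<n))) ⟩
    (+ 3) ⊙ (fromℤ n ⊖ S e k)          <⟨ close ⟩
    𝟙                                  ∎

  n≡L : n ≡ L
  n≡L = ℤP.≤-antisym (ℤP.≮⇒≥ L≮n) (ℤP.≮⇒≥ n≮L)

  surplus-impossible : Q a ≡ N a → e (+ suc a) ≡ false → e -[1+ a ] ≡ true → ⊥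
  surplus-impossible {a} same eₐ e₋ₐ = begin-contradiction
    P ⊕ Q K                            <⟨ x≺x⊕y (P ⊕ Q K) 𝟘≺φ^-[1+ suc (suc a) ] ⟩
    (P ⊕ Q K) ⊕ φ^ -[1+ suc (suc a) ]  ≡⟨ ⊕-assoc P (Q K) (φ^ -[1+ suc (suc a) ]) ⟩
    P ⊕ (Q K ⊕ φ^ -[1+ suc (suc a) ])  ≤⟨ ⊕-monoʳ-≼ P (first-difference (reflect-even even) even
                                                                          same eₐ e₋ₐ K a<K) ⟩
    P ⊕ N K                            ≡⟨ split T≤K ⟨
    S e K                              ≤⟨ below K ⟩
    fromℤ n                            ≡⟨ trans (cong fromℤ n≡L) (sym (pairing T≤K)) ⟩
    P ⊕ Q K                            ∎
    where
    K = suc a ℕ.+ T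
    T≤K = ℕP.m≤n+m T (suc a)
    a<K = ℕP.m≤m+n (suc a) T

  deficit-impossible : Q a ≡ N a → e (+ suc a) ≡ true → e -[1+ a ] ≡ false → ⊥
  deficit-impossible {a} same eₐ e₋ₐ =
    let m , 𝟙≼ = φ^-[1+]-archimedean (suc (suc a))
        k , K≤k , close = approx m (suc a ℕ.+ T)
        T≤k = ℕP.≤-trans (ℕP.m≤n+m T (suc a)) K≤k
        a<k = ℕP.≤-trans (ℕP.m≤m+n (suc a) T) K≤k
    in begin-contradiction
    𝟙                                  ≤⟨ 𝟙≼ ⟩
    (+ suc m) ⊙ φ^ -[1+ suc (suc a) ]  ≤⟨ ⊙-monoʳ-≼ (suc m) (⊕-≼⇒≼-⊖ (first-difference even
                                              (reflect-even even) (sym same) e₋ₐ eₐ k a<k)) ⟩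
    (+ suc m) ⊙ (Q k ⊖ N k)            ≡⟨ cong ((+ suc m) ⊙_) (gap T≤k) ⟨
    (+ suc m) ⊙ (fromℤ L ⊖ S e k)      ≡⟨ cong (λ l → (+ suc m) ⊙ (fromℤ l ⊖ S e k)) n≡L ⟨
    (+ suc m) ⊙ (fromℤ n ⊖ S e k)      <⟨ close ⟩
    𝟙                                  ∎

  mirrored : ∀ a → e (+ suc a) ≡ e -[1+ a ]
  mirrored = <-rec _ step
    where
    step : ∀ a → (∀ {b} → b ℕ.< a → e (+ suc b) ≡ e -[1+ b ]) → e (+ suc a) ≡ e -[1+ a ]
    step a earlier with e (+ suc a) in eₐ | e -[1+ a ] in e₋ₐ
    ... | true  | true  = refl
    ... | false | false = refl
    ... | false | true  = ⊥-elim (surplus-impossible (negPart-cong earlier) eₐ e₋ₐ)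
    ... | true  | false = ⊥-elim (deficit-impossible (negPart-cong earlier) eₐ e₋ₐ)

  antipalindromic : Antipalindromic e
  antipalindromic (+ zero)  = refl
  antipalindromic (+ suc a) = mirrored a
  antipalindromic -[1+ a ]  = sym (mirrored a)

fromℤ-mono-≤φ : ∀ {m n} → m ≤ n → fromℤ m ≤φ fromℤ n
fromℤ-mono-≤φ {m} {n} m≤n with m ℤP.≟ n
... | yes refl = inj₂ refl
... | no  m≢n  = inj₁ (inj₁ (0<p , ℤP.≤-refl))
  where
  0<n-m : + 0 < n - m
  0<n-m = subst (_< n - m) (ℤP.+-inverseʳ m) (ℤP.+-monoˡ-< (- m) (ℤP.≤∧≢⇒< m≤n m≢n))
  0<p : + 0 < + 2 * (n - m) + + 0
  0<p = subst (+ 0 <_) (sym (ℤP.+-identityʳ (+ 2 * (n - m)))) (ℤP.*-monoˡ-<-pos (+ 2) 0<n-m)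

module Antipalindromic⇒IntegerValue
  (e : ℤ → Bool) (even : AllExponentsEven e) (antipalindromic : Antipalindromic e)
  (T : ℕ) (vanish : VanishesAbove T e) where

  integral : ∀ k → S e k ≡ fromℤ (re (S e k))
  integral k = integral⇒fromℤ (begin
    im (S e k)                                 ≡⟨ cong im (S-split e k) ⟩
    im (posPart e k ⊕ negPart e k)             ≡⟨ cong (λ y → im (posPart e k ⊕ y)) mirror ⟩
    im (posPart e k ⊕ negPart (reflect e) k)   ≡⟨ posPart⊕mirror-integral even k ⟩
    + 0                                        ∎)
    where
    open ≡-Reasoning
    mirror : negPart e k ≡ negPart (reflect e) k
    mirror = negPart-cong {k} {e} {reflect e} λ {b} _ → antipalindromic -[1+ b ]

  stable : T ℕ.≤ k → S e k ≡ S e T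
  stable = stationary λ {k} T≤k →
    let eₖ = vanish (+ suc k) (+<+ (s≤s T≤k)) in
    trans (cong₂ (λ t t′ → (S e k ⊕ t) ⊕ t′)
                 (term-false {e} {+ suc k} eₖ)
                 (term-false {e} { -[1+ k ]} (trans (antipalindromic -[1+ k ]) eₖ)))
          (trans (⊕-identityʳ (S e k ⊕ 𝟘)) (⊕-identityʳ (S e k)))

  n : ℤ
  n = re (S e T)

  below : ∀ k → S e k ≤φ fromℤ n
  below k = subst (_≤φ fromℤ n) (sym (integral k)) (fromℤ-mono-≤φ (fromℤ-cancel-≼ (begin
    fromℤ (re (S e k))   ≡⟨ integral k ⟨
    S e k                ≤⟨ S-mono e (ℕP.m≤m+n k T) ⟩
    S e (k ℕ.+ T)        ≡⟨ stable (ℕP.m≤n+m T k) ⟩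
    S e T                ≡⟨ integral T ⟩
    fromℤ n              ∎)))
    where open ≼-Reasoning

  approx : ∀ m → ∃[ k ] ((+ suc m) ⊙ (fromℤ n ⊖ S e k)) <φ 𝟙
  approx m = T , subst (_<φ 𝟙) (sym vanishes) (inj₁ (decide , ℤP.≤-refl))
    where
    vanishes : (+ suc m) ⊙ (fromℤ n ⊖ S e T) ≡ 𝟘
    vanishes = trans (cong (λ s → (+ suc m) ⊙ (fromℤ n ⊖ s)) (integral T))
                     (trans (cong ((+ suc m) ⊙_) (⊖-self (fromℤ n))) (⊙-𝟘 (+ suc m)))

  value : HasValue e n
  value = below , approx

i≤+∣i∣ : ∀ i → i ≤ + ∣ i ∣
i≤+∣i∣ (+ n)     = ℤP.≤-refl
i≤+∣i∣ -[1+ n ] = ℤ.-≤+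

lemma3 : (e : ℤ → Bool) → IsBergmanRep e → AllExponentsEven e →
    IsIntegerValue e ⇔ Antipalindromic e
lemma3 e ((t , bounded) , _) even = mk⇔
  (λ (n , value) → IntegerValue⇒Antipalindromic.antipalindromic e even ∣ t ∣ vanish n value)
  (λ antipal → _ , Antipalindromic⇒IntegerValue.value e even antipal ∣ t ∣ vanish)
  where
  vanish : VanishesAbove ∣ t ∣ e
  vanish i ∣t∣<i = bounded i (ℤP.≤-<-trans (i≤+∣i∣ t) ∣t∣<i)
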